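{- Let $P=\{010,110\}$. Let $\mathfrak a_{n,m,f}$ be the number of $\sigma\in\mathcal{I}_n(010,110)$ with $\max(\sigma)=m$ and $|\mathbf{Forb}(\sigma,P)|=f$. Let $\mathfrak b_{n,k,f}$ be the number of words $\omega$ of length $n$ over $\{0,\dots,k-1\}$ avoiding $010$ and $110$ with $|\mathbf{Forb}(\omega,P)|=f$. Let $\mathfrak c_{n,k}$ be the number of words of length $\ell$ over $\{0,\dots,k-1\}$ avoiding $010$ and $110$, summed over $\ell\in\{0,\dots,n\}$ (so $\mathfrak c_{ -1,k}=0$). Then for all integers $2\leqslant f\leqslant m+1\leqslant n$, $$\mathfrak a_{n,m,f}=\sum_{p=m+1}^{n}\sum_{i=0}^{f-1}\sum_{j=0}^{m-1}\mathfrak a_{p-1,j,i}\Big(\mathfrak b_{n-p,m-i,f-i-1}+\delta_{f,m+1}\,\mathfrak c_{n-p-1,m-i}\Big),$$ where $\delta$ is the Kronecker delta.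
   Context: For $n\in\mathbb N$, an inversion sequence of size $n$ is a sequence $\sigma=(\sigma_1,\dots,\sigma_n)\in\mathbb N^n$ with $\sigma_i<i$ for all $i$. An integer sequence contains a pattern $\rho$ (a finite integer sequence such as $010$ or $110$) if it has a subsequence order-isomorphic to $\rho$, and avoids $\rho$ otherwise. $\mathcal{I}_n(P)$ denotes the set of inversion sequences of size $n$ avoiding every pattern in $P$. $\max(\sigma)$ is the largest entry of $\sigma$ ($-1$ for the empty sequence). For an integer sequence (or word) $\alpha$ avoiding the patterns in a set $P$, a value $v\in\{0,\dots,\max(\alpha)\}$ is forbidden by $\alpha$ and $P$ if the sequence $\alpha\cdot(M,v)$ (i.e. $\alpha$ followed by an entry $M$ and then an entry $v$) contains a pattern of $P$ whenever $M>\max(\alpha)$; $\mathbf{Forb}(\alpha,P)$ is the set of such forbidden values. -}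

module Defs where

open import Data.Nat using (ℕ; zero; suc; _+_; _∸_; _<_; _≤_; _≡ᵇ_)
open import Data.Integer as ℤ using (ℤ; +_; -1ℤ; _⊔_)
open import Data.Fin using (Fin; toℕ)
open import Data.List using (List; []; _∷_; _++_; length; lookup; map; upTo)
open import Data.Nat.ListAction using (sum)
open import Data.List.Relation.Unary.All using (All)
open import Data.List.Relation.Unary.Any using (Any)
open import Data.List.Relation.Unary.Unique.Propositional using (Unique)
open import Data.List.Membership.Propositional using (_∈_)
open import Data.List.Relation.Binary.Sublist.Propositional using (_⊆_)
open import Data.List.Relation.Binary.Pointwise using (Pointwise)
open import Data.Product using (Σ; ∃; _×_)
open import Data.Unit using (⊤)
open import Data.Empty using (⊥)
open import Data.Bool using (if_then_else_)
open import Relation.Nullary using (¬_)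
open import Relation.Binary.PropositionalEquality using (_≡_)
open import Function using (_⇔_)

SameCmp : ℕ → ℕ → ℕ → ℕ → Set
SameCmp x y x' y' = ((x < x') ⇔ (y < y')) × ((x ≡ x') ⇔ (y ≡ y')) × ((x' < x) ⇔ (y' < y))

OrderIso : List ℕ → List ℕ → Set
OrderIso []      []      = ⊤
OrderIso []      (_ ∷ _) = ⊥
OrderIso (_ ∷ _) []      = ⊥
OrderIso (x ∷ s) (y ∷ r) = Pointwise (SameCmp x y) s r × OrderIso s r

Contains : List ℕ → List ℕ → Set
Contains w ρ = ∃ λ s → (s ⊆ w) × OrderIso s ρ

ContainsSome : List (List ℕ) → List ℕ → Set
ContainsSome P w = Any (Contains w) P

Avoids : List (List ℕ) → List ℕ → Set
Avoids P w = All (λ ρ → ¬ Contains w ρ) P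

P010-110 : List (List ℕ)
P010-110 = (0 ∷ 1 ∷ 0 ∷ []) ∷ (1 ∷ 1 ∷ 0 ∷ []) ∷ []

maxℤ : List ℕ → ℤ
maxℤ []       = -1ℤ
maxℤ (x ∷ xs) = (+ x) ⊔ maxℤ xs

Forbidden : List (List ℕ) → List ℕ → ℕ → Set
Forbidden P α v =
  (+ v ℤ.≤ maxℤ α) ×
  (∀ (M : ℕ) → maxℤ α ℤ.< + M → ContainsSome P (α ++ (M ∷ v ∷ [])))

HasSize : {A : Set} → (A → Set) → ℕ → Set
HasSize {A} X k = Σ (List A) λ L → Unique L × (∀ x → (x ∈ L) ⇔ X x) × (length L ≡ k)

-- Inversion sequence of size n: σ_i < i (1-based), i.e. σ[i] ≤ i (0-based).
IsInvSeq : ℕ → List ℕ → Set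
IsInvSeq n σ = (length σ ≡ n) × (∀ (i : Fin (length σ)) → lookup σ i ≤ toℕ i)

IsWord : ℕ → ℕ → List ℕ → Set
IsWord n k ω = (length ω ≡ n) × All (_< k) ω

IsA : ℕ → ℕ → ℕ → ℕ → Set
IsA n m f a = HasSize (λ σ → IsInvSeq n σ × Avoids P010-110 σ × (maxℤ σ ≡ + m)
                             × HasSize (Forbidden P010-110 σ) f) a

IsB : ℕ → ℕ → ℕ → ℕ → Set
IsB n k f b = HasSize (λ ω → IsWord n k ω × Avoids P010-110 ω
                             × HasSize (Forbidden P010-110 ω) f) b

IsW : ℕ → ℕ → ℕ → Set
IsW ℓ k w = HasSize (λ ω → IsWord ℓ k ω × Avoids P010-110 ω) w

-- ∑_{x = lo}^{hi} F x   (empty if hi < lo)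
sumRange : ℕ → ℕ → (ℕ → ℕ) → ℕ
sumRange lo hi F = sum (map (λ t → F (lo + t)) (upTo (suc hi ∸ lo)))

-- cShift w N k = ∑_{ℓ=0}^{N-1} w ℓ k  =  𝔠_{N-1,k}  (so cShift w 0 k = 𝔠_{-1,k} = 0)
cShift : (ℕ → ℕ → ℕ) → ℕ → ℕ → ℕ
cShift w N k = sum (map (λ ℓ → w ℓ k) (upTo N))

δ : ℕ → ℕ → ℕ
δ a b = if a ≡ᵇ b then 1 else 0

-- Cut σ at the first occurrence of its maximum m: σ = τ · m · ω, where τ is an inversion
-- sequence of size p − 1 with maximum j < m and i = |Forb τ|. For a {010,110}-avoiding α,
-- Forb α consists of the entries of α and the values below a repeated entry, and σ avoids
-- the patterns iff τ and m · ω do and no entry of ω lies in Forb τ.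
-- If m ∉ ω, ranking the m − i values of {0,…,m−1} ∖ Forb τ turns ω into an arbitrary
-- avoiding word over m − i letters, and Forb σ is Forb τ, m, and the values whose rank is
-- forbidden by that word: this gives the 𝔟-term.
-- If m ∈ ω then Forb σ = {0,…,m}, so f = m + 1, and ω = ω₁ · m · m ⋯ m with ω₁ a word over
-- the same letters: this gives the 𝔠-term.
module Submission where

open import Defs
open import Data.Nat
open import Data.Nat.Properties
open import Data.Nat.ListAction using (sum)
open import Data.Integer as ℤ using (+_; +≤+; +<+; -<+)
import Data.Integer.Properties as ℤ
open import Data.Fin using (Fin; toℕ; zero; suc)
open import Data.List using (List; []; _∷_; _++_; length; map; upTo; filter; foldr; replicate; lookup)
open import Data.List.Properties
  using ( length-++; length-map; length-replicate; length-upTo; length-removeAt′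
        ; ∷-injective; ∷-injectiveˡ; ∷-injectiveʳ)
open import Data.List.Relation.Unary.All as All using (All; []; _∷_)
import Data.List.Relation.Unary.All.Properties as All
open import Data.List.Relation.Unary.Any using (here; there; index)
open import Data.List.Relation.Unary.Unique.Propositional using (Unique; []; _∷_)
import Data.List.Relation.Unary.Unique.Propositional.Properties as Unique
open import Data.List.Membership.Propositional using (_∈_; _∉_; _─_)
open import Data.List.Membership.Propositional.Properties
  using (∈-++⁺ˡ; ∈-++⁺ʳ; ∈-++⁻; ∈-map⁺; ∈-map⁻; ∈-upTo⁺; ∈-upTo⁻; ∈-filter⁺; ∈-filter⁻)
open import Data.List.Membership.DecPropositional _≟_ using (_∈?_)
open import Data.List.Relation.Binary.Sublist.Propositional
  using (_⊆_; []; _∷_; _∷ʳ_; ⊆-refl; ⊆-trans; to∈; from∈)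
open import Data.List.Relation.Binary.Sublist.Propositional.Properties
  using (∷ˡ⁻; ++⁺; ++⁺ˡ; ++⁺ʳ; map⁺)
open import Data.List.Relation.Binary.Pointwise using ([]; _∷_)
open import Data.Product using (∃; _×_; _,_; proj₁; proj₂)
open import Data.Sum as Sum using (_⊎_; inj₁; inj₂)
open import Data.Unit using (⊤; tt)
open import Data.Empty using (⊥-elim)
open import Relation.Nullary using (¬_; Dec; yes; no)
open import Relation.Nullary.Decidable using (_×-dec_; _⊎-dec_; ¬?; toSum)
open import Relation.Unary using (Decidable)
open import Relation.Binary using (tri<; tri≈; tri>)
open import Relation.Binary.PropositionalEquality
open import Function using (id; _∘_; _⇔_; mk⇔; Equivalence)
open Equivalence using (to; from)
import Function.Properties.Equivalence as ⇔

module _ {A : Set} where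

  ∈-─⁺ : ∀ {x z : A} {ys} (p : x ∈ ys) → z ∈ ys → z ≢ x → z ∈ ys ─ p
  ∈-─⁺ (here refl) (here refl) z≢x = ⊥-elim (z≢x refl)
  ∈-─⁺ (here _)    (there q)   _   = q
  ∈-─⁺ (there p)   (here e)    _   = here e
  ∈-─⁺ (there p)   (there q)   z≢x = there (∈-─⁺ p q z≢x)

  Unique-length-≤ : ∀ {xs ys : List A} → Unique xs → (∀ {z} → z ∈ xs → z ∈ ys) → length xs ≤ length ys
  Unique-length-≤ {[]}     _            _   = z≤n
  Unique-length-≤ {x ∷ xs} {ys} (x∉xs ∷ u) sub = begin
    suc (length xs)       ≤⟨ s≤s (Unique-length-≤ u sub′) ⟩
    suc (length (ys ─ p)) ≡⟨ length-removeAt′ ys (index p) ⟨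
    length ys             ∎
    where
    open ≤-Reasoning
    p = sub (here refl)
    sub′ : ∀ {z} → z ∈ xs → z ∈ ys ─ p
    sub′ z∈xs = ∈-─⁺ p (sub (there z∈xs)) (λ z≡x → All.lookup x∉xs z∈xs (sym z≡x))

  Unique-map⁺ : ∀ {B : Set} (f : A → B) {xs} → Unique xs →
                (∀ {x y} → x ∈ xs → y ∈ xs → f x ≡ f y → x ≡ y) → Unique (map f xs)
  Unique-map⁺ f []           inj = []
  Unique-map⁺ f {x ∷ xs} (x∉xs ∷ u) inj =
    All.tabulate fresh ∷ Unique-map⁺ f u (λ x∈ y∈ → inj (there x∈) (there y∈))
    where
    fresh : ∀ {z} → z ∈ map f xs → f x ≢ z
    fresh z∈ fx≡z with ∈-map⁻ f z∈
    ... | y , y∈xs , refl = All.lookup x∉xs y∈xs (inj (here refl) (there y∈xs) fx≡z)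

  HasSize-cong : ∀ {X Y : A → Set} {k} → (∀ x → X x ⇔ Y x) → HasSize X k → HasSize Y k
  HasSize-cong X⇔Y (L , u , mem , len) =
    L , u , (λ x → mk⇔ (to (X⇔Y x) ∘ to (mem x)) (from (mem x) ∘ from (X⇔Y x))) , len

  HasSize-functional : ∀ {X : A → Set} {k k′} → HasSize X k → HasSize X k′ → k ≡ k′
  HasSize-functional (L , u , mem , refl) (L′ , u′ , mem′ , refl) =
    ≤-antisym (Unique-length-≤ u  λ {z} z∈ → from (mem′ z) (to (mem z) z∈))
              (Unique-length-≤ u′ λ {z} z∈ → from (mem z) (to (mem′ z) z∈))

  HasSize-< : ∀ {X Y : A → Set} {k k′} → HasSize X k → HasSize Y k′ →
              (∀ x → X x → Y x) → (y : A) → Y y → ¬ X y → k < k′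
  HasSize-< (L , u , mem , refl) (L′ , u′ , mem′ , refl) X⊆Y y Yy ¬Xy =
    Unique-length-≤ (All.tabulate (λ z∈L y≡z → ¬Xy (to (mem _) (subst (_∈ L) (sym y≡z) z∈L))) ∷ u) sub
    where
    sub : ∀ {z} → z ∈ y ∷ L → z ∈ L′
    sub (here refl) = from (mem′ y) Yy
    sub (there z∈L) = from (mem′ _) (X⊆Y _ (to (mem _) z∈L))

  HasSize-∅ : ∀ {X : A → Set} → (∀ x → ¬ X x) → HasSize X 0
  HasSize-∅ ¬X = [] , [] , (λ x → mk⇔ (λ ()) (⊥-elim ∘ ¬X x)) , refl

  HasSize-⊎ : ∀ {X Y : A → Set} {k k′} → HasSize X k → HasSize Y k′ → (∀ x → X x → ¬ Y x) →
              HasSize (λ x → X x ⊎ Y x) (k + k′)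
  HasSize-⊎ {X} {Y} (L , u , mem , refl) (L′ , u′ , mem′ , refl) disjoint =
    L ++ L′ , Unique.++⁺ u u′ (λ {x} (x∈L , x∈L′) → disjoint x (to (mem x) x∈L) (to (mem′ x) x∈L′)) ,
    (λ x → mk⇔ (split x ∘ ∈-++⁻ L) join) , length-++ L
    where
    split : ∀ x → x ∈ L ⊎ x ∈ L′ → X x ⊎ Y x
    split x (inj₁ x∈L)  = inj₁ (to (mem x) x∈L)
    split x (inj₂ x∈L′) = inj₂ (to (mem′ x) x∈L′)
    join : ∀ {x} → X x ⊎ Y x → x ∈ L ++ L′
    join (inj₁ Xx) = ∈-++⁺ˡ (from (mem _) Xx)
    join (inj₂ Yx) = ∈-++⁺ʳ L (from (mem′ _) Yx)

  HasSize-image : ∀ {B : Set} {Y : A → Set} {k} (F : A → B) → HasSize Y k →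
                  (∀ {a a′} → Y a → Y a′ → F a ≡ F a′ → a ≡ a′) →
                  HasSize (λ b → ∃ λ a → Y a × b ≡ F a) k
  HasSize-image F (L , u , mem , refl) inj =
    map F L ,
    Unique-map⁺ F u (λ a∈ a′∈ → inj (to (mem _) a∈) (to (mem _) a′∈)) ,
    (λ b → mk⇔ (λ b∈ → let a , a∈ , b≡ = ∈-map⁻ F b∈ in a , to (mem a) a∈ , b≡)
               (λ { (a , Ya , refl) → ∈-map⁺ F (from (mem a) Ya) })) ,
    length-map F L

module _ {A B : Set} {X : A → Set} {Y : B → Set} (h : B → A) where

  private
    Section : List A → Set
    Section L = ∀ x → x ∈ L → ∃ λ y → Y y × h y ≡ x

    preimage : (L : List A) → Section L → List B
    preimage []      s = []
    preimage (x ∷ L) s = proj₁ (s x (here refl)) ∷ preimage L (λ z → s z ∘ there)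

    map-preimage : ∀ L (s : Section L) → map h (preimage L s) ≡ L
    map-preimage []      s = refl
    map-preimage (x ∷ L) s = cong₂ _∷_ (proj₂ (proj₂ (s x (here refl)))) (map-preimage L _)

    preimage-Y : ∀ L (s : Section L) {y} → y ∈ preimage L s → Y y
    preimage-Y (x ∷ L) s (here refl) = proj₁ (proj₂ (s x (here refl)))
    preimage-Y (x ∷ L) s (there y∈) = preimage-Y L _ y∈

  HasSize-bijection : ∀ {k} → HasSize X k → (∀ y → Y y → X (h y)) →
                      (∀ x → X x → ∃ λ y → Y y × h y ≡ x) →
                      (∀ {y y′} → Y y → Y y′ → h y ≡ h y′ → y ≡ y′) → HasSize Y k
  HasSize-bijection (L , u , mem , refl) maps-to onto inj =
    P , Unique.map⁻ (subst Unique (sym (map-preimage L s)) u) ,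
    (λ y → mk⇔ (preimage-Y L s) (complete y)) ,
    trans (sym (length-map h P)) (cong length (map-preimage L s))
    where
    s : Section L
    s x x∈L = onto x (to (mem x) x∈L)
    P = preimage L s
    complete : ∀ y → Y y → y ∈ P
    complete y Yy
      with ∈-map⁻ h (subst (h y ∈_) (sym (map-preimage L s)) (from (mem (h y)) (maps-to y Yy)))
    ... | y′ , y′∈P , hy≡hy′ = subst (_∈ P) (sym (inj Yy (preimage-Y L s y′∈P) hy≡hy′)) y′∈P

HasSize-⋃ : ∀ {I B C : Set} (L : List I) → Unique L → (Y : I → B → Set) (s : I → ℕ) (F : I → B → C) →
  (∀ a → a ∈ L → HasSize (Y a) (s a)) →
  (∀ {a a′ b b′} → a ∈ L → a′ ∈ L → Y a b → Y a′ b′ → F a b ≡ F a′ b′ → a ≡ a′ × b ≡ b′) →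
  HasSize (λ c → ∃ λ a → a ∈ L × ∃ λ b → Y a b × c ≡ F a b) (sum (map s L))
HasSize-⋃ []      _            Y s F size inj = HasSize-∅ λ { _ (_ , () , _) }
HasSize-⋃ (a ∷ L) (a∉L ∷ u) Y s F size inj =
  HasSize-cong (λ c → mk⇔ into out)
    (HasSize-⊎ (HasSize-image (F a) (size a (here refl)) λ Yb Yb′ → proj₂ ∘ inj (here refl) (here refl) Yb Yb′)
               (HasSize-⋃ L u Y s F (λ a′ → size a′ ∘ there) (λ a∈ a′∈ → inj (there a∈) (there a′∈)))
               disjoint)
  where
  disjoint : ∀ c → (∃ λ b → Y a b × c ≡ F a b) → ¬ (∃ λ a′ → a′ ∈ L × ∃ λ b → Y a′ b × c ≡ F a′ b)
  disjoint c (b , Yb , refl) (a′ , a′∈L , b′ , Yb′ , e) =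
    All.lookup a∉L a′∈L (proj₁ (inj (here refl) (there a′∈L) Yb Yb′ e))
  into : ∀ {c} → _ → ∃ λ a′ → a′ ∈ a ∷ L × ∃ λ b → Y a′ b × c ≡ F a′ b
  into (inj₁ r)              = a , here refl , r
  into (inj₂ (a′ , a′∈ , r)) = a′ , there a′∈ , r
  out : ∀ {c} → (∃ λ a′ → a′ ∈ a ∷ L × ∃ λ b → Y a′ b × c ≡ F a′ b) → _
  out (_  , here refl , r) = inj₁ r
  out (a′ , there a′∈ , r) = inj₂ (a′ , a′∈ , r)

HasSize-⋃-const : ∀ {I B C : Set} {X : I → Set} {k} (Y : I → B → Set) (s : ℕ) (F : I → B → C) →
  HasSize X k → (∀ a → X a → HasSize (Y a) s) →
  (∀ {a a′ b b′} → X a → X a′ → Y a b → Y a′ b′ → F a b ≡ F a′ b′ → a ≡ a′ × b ≡ b′) →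
  HasSize (λ c → ∃ λ a → X a × ∃ λ b → Y a b × c ≡ F a b) (k * s)
HasSize-⋃-const Y s F (L , u , mem , refl) size inj =
  subst (HasSize _) (sum-const L)
    (HasSize-cong (λ c → mk⇔ (λ (a , a∈ , r) → a , to (mem a) a∈ , r) (λ (a , Xa , r) → a , from (mem a) Xa , r))
      (HasSize-⋃ L u Y (λ _ → s) F (λ a → size a ∘ to (mem a))
         (λ a∈ a′∈ → inj (to (mem _) a∈) (to (mem _) a′∈))))
  where
  sum-const : ∀ {I : Set} (L : List I) → sum (map (λ _ → s) L) ≡ length L * s
  sum-const []      = refl
  sum-const (_ ∷ L) = cong (λ t → s + t) (sum-const L)

HasSize-⋃-range : ∀ {A : Set} lo hi (S : ℕ → A → Set) (F : ℕ → ℕ) →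
  (∀ x → lo ≤ x → x ≤ hi → HasSize (S x) (F x)) →
  (∀ {x x′ a} → lo ≤ x → x ≤ hi → S x a → lo ≤ x′ → x′ ≤ hi → S x′ a → x ≡ x′) →
  HasSize (λ a → ∃ λ x → lo ≤ x × x ≤ hi × S x a) (sumRange lo hi F)
HasSize-⋃-range lo hi S F size disjoint =
  HasSize-cong (λ a → mk⇔ into out)
    (HasSize-⋃ (upTo (suc hi ∸ lo)) (Unique.upTo⁺ _) (λ t → S (lo + t)) (λ t → F (lo + t)) (λ _ a → a)
       (λ t t∈ → size (lo + t) (m≤m+n lo t) (bound t∈))
       (λ { {t} {t′} t∈ t′∈ St St′ refl →
           +-cancelˡ-≡ lo t t′ (disjoint (m≤m+n lo t) (bound t∈) St (m≤m+n lo t′) (bound t′∈) St′) , refl }))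
  where
  bound : ∀ {t} → t ∈ upTo (suc hi ∸ lo) → lo + t ≤ hi
  bound {t} t∈ = ≤-pred (begin-strict
    lo + t             <⟨ +-monoʳ-< lo t< ⟩
    lo + (suc hi ∸ lo) ≡⟨ m+[n∸m]≡n {lo} (<⇒≤ (m∸n≢0⇒n<m (m<n⇒n≢0 t<))) ⟩
    suc hi             ∎)
    where
    open ≤-Reasoning
    t< = ∈-upTo⁻ t∈
  into : ∀ {a} → _ → ∃ λ x → lo ≤ x × x ≤ hi × S x a
  into (t , t∈ , a , St , refl) = lo + t , m≤m+n lo t , bound t∈ , St
  out : ∀ {a} → ∃ (λ x → lo ≤ x × x ≤ hi × S x a) → _
  out (x , lo≤x , x≤hi , Sx) =
    x ∸ lo , ∈-upTo⁺ (∸-monoˡ-< (s≤s x≤hi) lo≤x) , _ , subst (λ y → S y _) (sym (m+[n∸m]≡n lo≤x)) Sx , refl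

HasSize-<n : ∀ n → HasSize (_< n) n
HasSize-<n n = upTo n , Unique.upTo⁺ n , (λ x → mk⇔ ∈-upTo⁻ ∈-upTo⁺) , length-upTo n

HasSize-≡ : ∀ (c : ℕ) → HasSize (_≡ c) 1
HasSize-≡ c = c ∷ [] , [] ∷ [] , (λ x → mk⇔ (λ { (here e) → e ; (there ()) }) here) , refl

HasSize-bounded : ∀ {Q : ℕ → Set} → Decidable Q → ∀ B → (∀ v → Q v → v < B) → ∃ (HasSize Q)
HasSize-bounded {Q} Q? B bounded = length L , L , Unique.filter⁺ Q? (Unique.upTo⁺ B) ,
  (λ x → mk⇔ (proj₂ ∘ ∈-filter⁻ Q? {xs = upTo B}) (λ Qx → ∈-filter⁺ Q? (∈-upTo⁺ (bounded x Qx)) Qx)) , refl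
  where L = filter Q? (upTo B)

Is010∨110 : ℕ → ℕ → ℕ → Set
Is010∨110 x y z = (x ≡ z × x < y) ⊎ (x ≡ y × z < x)

Has010∨110 : List ℕ → Set
Has010∨110 w = ∃ λ x → ∃ λ y → ∃ λ z → x ∷ y ∷ z ∷ [] ⊆ w × Is010∨110 x y z

AvoidsP : List ℕ → Set
AvoidsP = Avoids P010-110

sameCmp-< : ∀ {x y x′ y′} → x < x′ → y < y′ → SameCmp x y x′ y′
sameCmp-< x<x′ y<y′ =
  mk⇔ (λ _ → y<y′) (λ _ → x<x′) ,
  mk⇔ (λ x≡x′ → ⊥-elim (<-irrefl x≡x′ x<x′)) (λ y≡y′ → ⊥-elim (<-irrefl y≡y′ y<y′)) ,
  mk⇔ (λ x′<x → ⊥-elim (<-asym x<x′ x′<x)) (λ y′<y → ⊥-elim (<-asym y<y′ y′<y))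

sameCmp-≡ : ∀ {x y} → SameCmp x y x y
sameCmp-≡ = mk⇔ (⊥-elim ∘ <-irrefl refl) (⊥-elim ∘ <-irrefl refl) ,
            mk⇔ (λ _ → refl) (λ _ → refl) ,
            mk⇔ (⊥-elim ∘ <-irrefl refl) (⊥-elim ∘ <-irrefl refl)

sameCmp-> : ∀ {x y x′ y′} → x′ < x → y′ < y → SameCmp x y x′ y′
sameCmp-> x′<x y′<y =
  mk⇔ (λ x<x′ → ⊥-elim (<-asym x′<x x<x′)) (λ y<y′ → ⊥-elim (<-asym y′<y y<y′)) ,
  mk⇔ (λ x≡x′ → ⊥-elim (<-irrefl (sym x≡x′) x′<x)) (λ y≡y′ → ⊥-elim (<-irrefl (sym y≡y′) y′<y)) ,
  mk⇔ (λ _ → y′<y) (λ _ → x′<x)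

has010∨110⇒containsSome : ∀ {w} → Has010∨110 w → ContainsSome P010-110 w
has010∨110⇒containsSome (x , y , z , s , inj₁ (refl , x<y)) =
  here (x ∷ y ∷ x ∷ [] , s , (sameCmp-< x<y z<s ∷ sameCmp-≡ ∷ []) , (sameCmp-> x<y z<s ∷ []) , [] , tt)
has010∨110⇒containsSome (x , y , z , s , inj₂ (refl , z<x)) =
  there (here (x ∷ x ∷ z ∷ [] , s , (sameCmp-≡ ∷ sameCmp-> z<x z<s ∷ []) , (sameCmp-> z<x z<s ∷ []) , [] , tt))

contains010⇒has010∨110 : ∀ {w} → Contains w (0 ∷ 1 ∷ 0 ∷ []) → Has010∨110 w
contains010⇒has010∨110 (x ∷ y ∷ z ∷ [] , s , (x~y ∷ x~z ∷ []) , _) =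
  x , y , z , s , inj₁ (from (proj₁ (proj₂ x~z)) refl , from (proj₁ x~y) z<s)

contains110⇒has010∨110 : ∀ {w} → Contains w (1 ∷ 1 ∷ 0 ∷ []) → Has010∨110 w
contains110⇒has010∨110 (x ∷ y ∷ z ∷ [] , s , (x~y ∷ x~z ∷ []) , _) =
  x , y , z , s , inj₂ (from (proj₁ (proj₂ x~y)) refl , from (proj₂ (proj₂ x~z)) z<s)

containsSome⇒has010∨110 : ∀ {w} → ContainsSome P010-110 w → Has010∨110 w
containsSome⇒has010∨110 (here c)         = contains010⇒has010∨110 c
containsSome⇒has010∨110 (there (here c)) = contains110⇒has010∨110 c

avoidsP⇒¬has010∨110 : ∀ {w} → AvoidsP w → ¬ Has010∨110 w
avoidsP⇒¬has010∨110 (¬010 ∷ ¬110 ∷ []) h with has010∨110⇒containsSome h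
... | here c         = ¬010 c
... | there (here c) = ¬110 c

¬has010∨110⇒avoidsP : ∀ {w} → ¬ Has010∨110 w → AvoidsP w
¬has010∨110⇒avoidsP ¬h = (¬h ∘ contains010⇒has010∨110) ∷ (¬h ∘ contains110⇒has010∨110) ∷ []

has010∨110-mono : ∀ {u w} → u ⊆ w → Has010∨110 u → Has010∨110 w
has010∨110-mono u⊆w (x , y , z , s , occ) = x , y , z , ⊆-trans s u⊆w , occ

avoidsP-antimono : ∀ {u w} → u ⊆ w → AvoidsP w → AvoidsP u
avoidsP-antimono u⊆w av = ¬has010∨110⇒avoidsP (avoidsP⇒¬has010∨110 av ∘ has010∨110-mono u⊆w)

module _ {A : Set} where

  record ⊆-++-Split (s α β : List A) : Set where
    constructor split
    field
      {s₁ s₂} : List A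
      s₁⊆α : s₁ ⊆ α
      s₂⊆β : s₂ ⊆ β
      s≡ : s ≡ s₁ ++ s₂

  ⊆-++-split : ∀ {s} α {β} → s ⊆ α ++ β → ⊆-++-Split s α β
  ⊆-++-split []      s⊆β = split [] s⊆β refl
  ⊆-++-split (a ∷ α) (.a ∷ʳ s⊆) with ⊆-++-split α s⊆
  ... | split p q refl = split (a ∷ʳ p) q refl
  ⊆-++-split (a ∷ α) (e ∷ s⊆) with ⊆-++-split α s⊆
  ... | split p q refl = split (e ∷ p) q refl

  data Pair⊆++ (x y : A) (α β : List A) : Set where
    both-left  : x ∷ y ∷ [] ⊆ α → Pair⊆++ x y α β
    straddle   : x ∈ α → y ∈ β → Pair⊆++ x y α β
    both-right : x ∷ y ∷ [] ⊆ β → Pair⊆++ x y α β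

  pair⊆++ : ∀ {x y} α {β} → x ∷ y ∷ [] ⊆ α ++ β → Pair⊆++ x y α β
  pair⊆++ α p with ⊆-++-split α p
  ... | split {[]}            _ q refl = both-right q
  ... | split {_ ∷ []}        p q refl = straddle (to∈ p) (to∈ q)
  ... | split {_ ∷ _ ∷ []} {[]} p _ refl = both-left p

  data Triple⊆++ (x y z : A) (α β : List A) : Set where
    3+0 : x ∷ y ∷ z ∷ [] ⊆ α → Triple⊆++ x y z α β
    2+1 : x ∷ y ∷ [] ⊆ α → z ∈ β → Triple⊆++ x y z α β
    1+2 : x ∈ α → y ∷ z ∷ [] ⊆ β → Triple⊆++ x y z α β
    0+3 : x ∷ y ∷ z ∷ [] ⊆ β → Triple⊆++ x y z α β

  triple⊆++ : ∀ {x y z} α {β} → x ∷ y ∷ z ∷ [] ⊆ α ++ β → Triple⊆++ x y z α β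
  triple⊆++ α p with ⊆-++-split α p
  ... | split {[]}                    _ q refl = 0+3 q
  ... | split {_ ∷ []}                p q refl = 1+2 (to∈ p) q
  ... | split {_ ∷ _ ∷ []}            p q refl = 2+1 p (to∈ q)
  ... | split {_ ∷ _ ∷ _ ∷ []} {[]} p _ refl = 3+0 p

⊆-map⁻ : ∀ {A B : Set} {s} (g : A → B) w → s ⊆ map g w → ∃ λ s′ → s′ ⊆ w × s ≡ map g s′
⊆-map⁻ g []      []          = [] , [] , refl
⊆-map⁻ g (a ∷ w) (_ ∷ʳ p)    = let s′ , q , e = ⊆-map⁻ g w p in s′ , a ∷ʳ q , e
⊆-map⁻ g (a ∷ w) (refl ∷ p)  = let s′ , q , e = ⊆-map⁻ g w p in a ∷ s′ , refl ∷ q , cong (g a ∷_) e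

-- The forbidden values of a pattern-avoiding sequence

BelowRepeat : List ℕ → ℕ → Set
BelowRepeat α v = ∃ λ x → x ∷ x ∷ [] ⊆ α × v < x

Forb : List ℕ → ℕ → Set
Forb α v = v ∈ α ⊎ BelowRepeat α v

Forb-mono : ∀ {u w v} → u ⊆ w → Forb u v → Forb w v
Forb-mono u⊆w (inj₁ v∈u)          = inj₁ (to∈ (⊆-trans (from∈ v∈u) u⊆w))
Forb-mono u⊆w (inj₂ (x , xx , v<x)) = inj₂ (x , ⊆-trans xx u⊆w , v<x)

Forb-≤ : ∀ {α v B} → All (_≤ B) α → Forb α v → v ≤ B
Forb-≤ α≤B (inj₁ v∈α)          = All.lookup α≤B v∈α
Forb-≤ α≤B (inj₂ (x , xx , v<x)) = ≤-trans (<⇒≤ v<x) (All.lookup α≤B (to∈ xx))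

Forb-< : ∀ {α v B} → All (_< B) α → Forb α v → v < B
Forb-< α<B (inj₁ v∈α)          = All.lookup α<B v∈α
Forb-< α<B (inj₂ (x , xx , v<x)) = <-trans v<x (All.lookup α<B (to∈ xx))

belowRepeat? : ∀ α v → Dec (BelowRepeat α v)
belowRepeat? []      v = no λ { (_ , () , _) }
belowRepeat? (a ∷ α) v with belowRepeat? α v
... | yes (x , xx , v<x) = yes (x , a ∷ʳ xx , v<x)
... | no ¬r with v <? a ×-dec a ∈? α
...   | yes (v<a , a∈α) = yes (a , refl ∷ from∈ a∈α , v<a)
...   | no ¬a = no λ { (x , _ ∷ʳ xx , v<x) → ¬r (x , xx , v<x)
                     ; (x , refl ∷ xx , v<x) → ¬a (v<x , to∈ xx) }

forb? : ∀ α v → Dec (Forb α v)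
forb? α v = v ∈? α ⊎-dec belowRepeat? α v

maxℕ : List ℕ → ℕ
maxℕ = foldr _⊔_ 0

maxℤ-∷ : ∀ x xs → maxℤ (x ∷ xs) ≡ + maxℕ (x ∷ xs)
maxℤ-∷ x []       = cong +_ (sym (⊔-identityʳ x))
maxℤ-∷ x (y ∷ ys) rewrite maxℤ-∷ y ys = refl

maxℕ-upper : ∀ {x α} → x ∈ α → x ≤ maxℕ α
maxℕ-upper {α = a ∷ α} (here refl) = m≤m⊔n a (maxℕ α)
maxℕ-upper {α = a ∷ α} (there x∈α) = ≤-trans (maxℕ-upper x∈α) (m≤n⊔m a (maxℕ α))

maxℕ-least : ∀ {α B} → All (_≤ B) α → maxℕ α ≤ B
maxℕ-least []          = z≤n
maxℕ-least (a≤B ∷ α≤B) = ⊔-lub a≤B (maxℕ-least α≤B)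

maxℕ-∈ : ∀ x xs → maxℕ (x ∷ xs) ∈ x ∷ xs
maxℕ-∈ x []       = here (⊔-identityʳ x)
maxℕ-∈ x (y ∷ ys) with ⊔-sel x (maxℕ (y ∷ ys))
... | inj₁ e = here e
... | inj₂ e = there (subst (_∈ y ∷ ys) (sym e) (maxℕ-∈ y ys))

maxℤ≡⇒ : ∀ {α j} → maxℤ α ≡ + j → j ∈ α × All (_≤ j) α
maxℤ≡⇒ {a ∷ α} e rewrite maxℤ-∷ a α with e
... | refl = maxℕ-∈ a α , All.tabulate maxℕ-upper

maxℤ≡⇐ : ∀ {α j} → j ∈ α → All (_≤ j) α → maxℤ α ≡ + j
maxℤ≡⇐ {a ∷ α} j∈α α≤j rewrite maxℤ-∷ a α = cong +_ (≤-antisym (maxℕ-least α≤j) (maxℕ-upper j∈α))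

maxℤ-nonempty : ∀ α → 1 ≤ length α → ∃ λ j → maxℤ α ≡ + j
maxℤ-nonempty (x ∷ xs) _ = maxℕ (x ∷ xs) , maxℤ-∷ x xs

≤maxℤ : ∀ {x v α} → x ∈ α → v ≤ x → + v ℤ.≤ maxℤ α
≤maxℤ {α = a ∷ α} x∈α v≤x rewrite maxℤ-∷ a α = +≤+ (≤-trans v≤x (maxℕ-upper x∈α))

maxℤ<⇒< : ∀ {x α M} → x ∈ α → maxℤ α ℤ.< + M → x < M
maxℤ<⇒< {α = a ∷ α} x∈α max<M rewrite maxℤ-∷ a α with max<M
... | +<+ maxℕ<M = ≤-<-trans (maxℕ-upper x∈α) maxℕ<M

maxℤ<1+maxℕ : ∀ α → maxℤ α ℤ.< + suc (maxℕ α)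
maxℤ<1+maxℕ []      = -<+
maxℤ<1+maxℕ (a ∷ α) rewrite maxℤ-∷ a α = +<+ ≤-refl

Forb⇒Forbidden : ∀ {α v} → Forb α v → Forbidden P010-110 α v
Forb⇒Forbidden {v = v} (inj₁ v∈α) = ≤maxℤ v∈α ≤-refl ,
  λ M max<M → has010∨110⇒containsSome
    (v , M , v , ++⁺ (from∈ v∈α) ⊆-refl , inj₁ (refl , maxℤ<⇒< v∈α max<M))
Forb⇒Forbidden {v = v} (inj₂ (x , xx , v<x)) = ≤maxℤ (to∈ xx) (<⇒≤ v<x) ,
  λ M _ → has010∨110⇒containsSome (x , x , v , ++⁺ xx (M ∷ʳ ⊆-refl) , inj₂ (refl , v<x))

private
  ⊆-pair : ∀ {y z a b : ℕ} → y ∷ z ∷ [] ⊆ a ∷ b ∷ [] → y ≡ a × z ≡ b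
  ⊆-pair (y≡a ∷ z≡b ∷ []) = y≡a , z≡b
  ⊆-pair (y≡a ∷ _ ∷ʳ ())
  ⊆-pair (_ ∷ʳ _ ∷ ())
  ⊆-pair (_ ∷ʳ _ ∷ʳ ())

  occurrence⇒Forb : ∀ {α x y z v M} → AvoidsP α → All (_< M) α →
    Triple⊆++ x y z α (M ∷ v ∷ []) → Is010∨110 x y z → Forb α v
  occurrence⇒Forb {x = x} {y} {z} av _ (3+0 p) occ = ⊥-elim (avoidsP⇒¬has010∨110 av (x , y , z , p , occ))
  occurrence⇒Forb av α<M (2+1 p (here refl)) (inj₁ (refl , _)) = ⊥-elim (<-irrefl refl (All.lookup α<M (to∈ p)))
  occurrence⇒Forb av α<M (2+1 p (here refl)) (inj₂ (_ , M<x)) = ⊥-elim (<-asym M<x (All.lookup α<M (to∈ p)))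
  occurrence⇒Forb av α<M (2+1 p (there (here refl))) (inj₁ (refl , _)) = inj₁ (to∈ p)
  occurrence⇒Forb {x = x} av α<M (2+1 p (there (here refl))) (inj₂ (refl , v<x)) = inj₂ (x , p , v<x)
  occurrence⇒Forb av α<M (1+2 x∈α p) occ with ⊆-pair p
  occurrence⇒Forb av α<M (1+2 x∈α p) (inj₁ (refl , _)) | refl , refl = inj₁ x∈α
  occurrence⇒Forb av α<M (1+2 x∈α p) (inj₂ (refl , _)) | refl , refl = ⊥-elim (<-irrefl refl (All.lookup α<M x∈α))
  occurrence⇒Forb av α<M (0+3 (_ ∷ʳ _ ∷ʳ ())) _
  occurrence⇒Forb av α<M (0+3 (_ ∷ʳ _ ∷ ())) _
  occurrence⇒Forb av α<M (0+3 (_ ∷ _ ∷ʳ ())) _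
  occurrence⇒Forb av α<M (0+3 (_ ∷ _ ∷ ())) _

Forbidden⇒Forb : ∀ {α v} → AvoidsP α → Forbidden P010-110 α v → Forb α v
Forbidden⇒Forb {α} av (_ , forced) with containsSome⇒has010∨110 (forced (suc (maxℕ α)) (maxℤ<1+maxℕ α))
... | x , y , z , p , occ =
  occurrence⇒Forb av (All.tabulate (s≤s ∘ maxℕ-upper)) (triple⊆++ α p) occ

Forb⇔Forbidden : ∀ {α v} → AvoidsP α → Forb α v ⇔ Forbidden P010-110 α v
Forb⇔Forbidden av = mk⇔ Forb⇒Forbidden (Forbidden⇒Forb av)

HasSize-Forb⇔Forbidden : ∀ {α k} → AvoidsP α → HasSize (Forb α) k ⇔ HasSize (Forbidden P010-110 α) k
HasSize-Forb⇔Forbidden av =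
  mk⇔ (HasSize-cong (λ _ → Forb⇔Forbidden av)) (HasSize-cong (λ _ → ⇔.sym (Forb⇔Forbidden av)))

HasSize-Forb : ∀ α → ∃ (HasSize (Forb α))
HasSize-Forb α = HasSize-bounded (forb? α) (suc (maxℕ α)) (λ v → s≤s ∘ Forb-≤ (All.tabulate maxℕ-upper))

Allowed : List ℕ → ℕ → Set
Allowed τ v = ¬ Forb τ v

module _ {τ : List ℕ} {m : ℕ} (τ<m : All (_< m) τ) where

  avoidsP-++∷⁻ : ∀ {ω} → AvoidsP (τ ++ m ∷ ω) → AvoidsP τ × All (Allowed τ) ω × AvoidsP (m ∷ ω)
  avoidsP-++∷⁻ {ω} av =
    avoidsP-antimono (++⁺ʳ _ ⊆-refl) av ,
    All.tabulate (λ x∈ω → avoidsP⇒¬has010∨110 av ∘ occurrence x∈ω) ,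
    avoidsP-antimono (++⁺ˡ τ ⊆-refl) av
    where
    occurrence : ∀ {x} → x ∈ ω → Forb τ x → Has010∨110 (τ ++ m ∷ ω)
    occurrence {x} x∈ω (inj₁ x∈τ) =
      x , m , x , ++⁺ (from∈ x∈τ) (refl ∷ from∈ x∈ω) , inj₁ (refl , All.lookup τ<m x∈τ)
    occurrence {x} x∈ω (inj₂ (y , yy , x<y)) =
      y , y , x , ++⁺ yy (m ∷ʳ from∈ x∈ω) , inj₂ (refl , x<y)

  avoidsP-++∷⁺ : ∀ {ω} → AvoidsP τ → All (Allowed τ) ω → AvoidsP (m ∷ ω) → AvoidsP (τ ++ m ∷ ω)
  avoidsP-++∷⁺ {ω} avτ allowed avω = ¬has010∨110⇒avoidsP λ (x , y , z , p , occ) → no-occ (triple⊆++ τ p) occ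
    where
    x<m : ∀ {x} → x ∈ τ → x < m
    x<m = All.lookup τ<m
    no-occ : ∀ {x y z} → Triple⊆++ x y z τ (m ∷ ω) → ¬ Is010∨110 x y z
    no-occ {x} {y} {z} (3+0 p) occ = avoidsP⇒¬has010∨110 avτ (x , y , z , p , occ)
    no-occ {x} {y} {z} (0+3 p) occ = avoidsP⇒¬has010∨110 avω (x , y , z , p , occ)
    no-occ (2+1 p (here refl))  (inj₁ (refl , _))   = <-irrefl refl (x<m (to∈ p))
    no-occ (2+1 p (there z∈ω))  (inj₁ (refl , _))   = All.lookup allowed z∈ω (inj₁ (to∈ p))
    no-occ (2+1 p (here refl))  (inj₂ (refl , m<x)) = <-asym m<x (x<m (to∈ p))
    no-occ {x} (2+1 p (there z∈ω)) (inj₂ (refl , z<x)) = All.lookup allowed z∈ω (inj₂ (x , p , z<x))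
    no-occ (1+2 x∈τ p) (inj₁ (refl , _)) with to∈ (∷ˡ⁻ p)
    ... | here refl  = <-irrefl refl (x<m x∈τ)
    ... | there x∈ω  = All.lookup allowed x∈ω (inj₁ x∈τ)
    no-occ (1+2 x∈τ p) (inj₂ (refl , _)) with to∈ p
    ... | here refl  = <-irrefl refl (x<m x∈τ)
    ... | there x∈ω  = All.lookup allowed x∈ω (inj₁ x∈τ)

  Forb-++∷⁻ : ∀ {ω v} → All (Allowed τ) ω → Forb (τ ++ m ∷ ω) v → Forb τ v ⊎ Forb (m ∷ ω) v
  Forb-++∷⁻ _ (inj₁ v∈) with ∈-++⁻ τ v∈
  ... | inj₁ v∈τ  = inj₁ (inj₁ v∈τ)
  ... | inj₂ v∈mω = inj₂ (inj₁ v∈mω)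
  Forb-++∷⁻ allowed (inj₂ (x , xx , v<x)) with pair⊆++ τ xx
  ... | both-left p  = inj₁ (inj₂ (x , p , v<x))
  ... | both-right p = inj₂ (inj₂ (x , p , v<x))
  ... | straddle x∈τ (here refl) = ⊥-elim (<-irrefl refl (All.lookup τ<m x∈τ))
  ... | straddle x∈τ (there x∈ω) = ⊥-elim (All.lookup allowed x∈ω (inj₁ x∈τ))

  Forb-++∷⁺ : ∀ {ω v} → Forb τ v ⊎ Forb (m ∷ ω) v → Forb (τ ++ m ∷ ω) v
  Forb-++∷⁺ (inj₁ f) = Forb-mono (++⁺ʳ _ ⊆-refl) f
  Forb-++∷⁺ (inj₂ f) = Forb-mono (++⁺ˡ τ ⊆-refl) f

Forb-∷⁻ : ∀ {m ω v} → m ∉ ω → Forb (m ∷ ω) v → v ≡ m ⊎ Forb ω v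
Forb-∷⁻ m∉ω (inj₁ (here v≡m))             = inj₁ v≡m
Forb-∷⁻ m∉ω (inj₁ (there v∈ω))            = inj₂ (inj₁ v∈ω)
Forb-∷⁻ m∉ω (inj₂ (x , _ ∷ʳ xx , v<x))    = inj₂ (inj₂ (x , xx , v<x))
Forb-∷⁻ m∉ω (inj₂ (x , refl ∷ xx , v<x)) = ⊥-elim (m∉ω (to∈ xx))

Forb-∷⁺ : ∀ {m ω v} → v ≡ m ⊎ Forb ω v → Forb (m ∷ ω) v
Forb-∷⁺ (inj₁ v≡m)     = inj₁ (here v≡m)
Forb-∷⁺ {m} (inj₂ f)   = Forb-mono (m ∷ʳ ⊆-refl) f

Forb-∷-repeated : ∀ {m ω v} → m ∈ ω → v ≤ m → Forb (m ∷ ω) v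
Forb-∷-repeated {m} m∈ω v≤m with m≤n⇒m<n∨m≡n v≤m
... | inj₁ v<m = inj₂ (m , refl ∷ from∈ m∈ω , v<m)
... | inj₂ v≡m = inj₁ (here v≡m)

private
  last<max : ∀ {x y z m} → Is010∨110 x y z → x ≤ m → y ≤ m → z < m
  last<max (inj₁ (refl , x<y)) x≤m y≤m = <-≤-trans x<y y≤m
  last<max (inj₂ (_ , z<x))   x≤m y≤m = <-≤-trans z<x x≤m

  ∈-replicate⁻ : ∀ {z m : ℕ} k → z ∈ replicate k m → z ≡ m
  ∈-replicate⁻ (suc k) (here z≡m)  = z≡m
  ∈-replicate⁻ (suc k) (there z∈) = ∈-replicate⁻ k z∈

avoidsP-++-replicate : ∀ {α m} k → All (_≤ m) α → AvoidsP α → AvoidsP (α ++ replicate k m)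
avoidsP-++-replicate {α} {m} k α≤m av = ¬has010∨110⇒avoidsP λ (x , y , z , p , occ) → no-occ (triple⊆++ α p) occ
  where
  is-m : ∀ {z} → z ∈ replicate k m → z ≡ m
  is-m = ∈-replicate⁻ k
  no-occ : ∀ {x y z} → Triple⊆++ x y z α (replicate k m) → ¬ Is010∨110 x y z
  no-occ {x} {y} {z} (3+0 p) occ = avoidsP⇒¬has010∨110 av (x , y , z , p , occ)
  no-occ (2+1 p z∈) occ =
    <-irrefl (is-m z∈) (last<max occ (All.lookup α≤m (to∈ p)) (All.lookup α≤m (to∈ (∷ˡ⁻ p))))
  no-occ (1+2 x∈α p) occ =
    <-irrefl (is-m (to∈ (∷ˡ⁻ p))) (last<max occ (All.lookup α≤m x∈α) (≤-reflexive (is-m (to∈ p))))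
  no-occ (0+3 p) occ =
    <-irrefl (is-m (to∈ (∷ˡ⁻ (∷ˡ⁻ p))))
      (last<max occ (≤-reflexive (is-m (to∈ p))) (≤-reflexive (is-m (to∈ (∷ˡ⁻ p)))))

avoidsP-∷-max : ∀ {m ω} → All (_< m) ω → AvoidsP ω → AvoidsP (m ∷ ω)
avoidsP-∷-max {m} {ω} ω<m av = ¬has010∨110⇒avoidsP λ (x , y , z , p , occ) → no-occ p occ
  where
  no-occ : ∀ {x y z} → x ∷ y ∷ z ∷ [] ⊆ m ∷ ω → ¬ Is010∨110 x y z
  no-occ (refl ∷ p) (inj₁ (refl , _)) = <-irrefl refl (All.lookup ω<m (to∈ (∷ˡ⁻ p)))
  no-occ (refl ∷ p) (inj₂ (refl , _)) = <-irrefl refl (All.lookup ω<m (to∈ p))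
  no-occ {x} {y} {z} (_ ∷ʳ p) occ     = avoidsP⇒¬has010∨110 av (x , y , z , p , occ)

-- Order-preserving relabelling of the values satisfying a decidable predicate

module Rank {Q : ℕ → Set} (Q? : Decidable Q) where

  rank : ℕ → ℕ
  rank zero = 0
  rank (suc x) with Q? x
  ... | yes _ = suc (rank x)
  ... | no _  = rank x

  rank-step : ∀ x → rank x ≤ rank (suc x)
  rank-step x with Q? x
  ... | yes _ = n≤1+n _
  ... | no _  = ≤-refl

  rank-mono : ∀ {x y} → x ≤ y → rank x ≤ rank y
  rank-mono = mono′ ∘ ≤⇒≤′
    where
    mono′ : ∀ {x y} → x ≤′ y → rank x ≤ rank y
    mono′ ≤′-refl        = ≤-refl
    mono′ (≤′-step x≤′y) = ≤-trans (mono′ x≤′y) (rank-step _)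

  rank-suc : ∀ {x} → Q x → rank (suc x) ≡ suc (rank x)
  rank-suc {x} Qx with Q? x
  ... | yes _  = refl
  ... | no ¬Qx = ⊥-elim (¬Qx Qx)

  rank-strict : ∀ {x y} → Q x → x < y → rank x < rank y
  rank-strict Qx x<y = subst (_≤ _) (rank-suc Qx) (rank-mono x<y)

  rank-surjective : ∀ x {k} → k < rank x → ∃ λ y → y < x × Q y × rank y ≡ k
  rank-surjective (suc x) {k} k< with Q? x
  ... | no _ = let y , y<x , Qy , e = rank-surjective x k< in y , m<n⇒m<1+n y<x , Qy , e
  ... | yes Qx with m≤n⇒m<n∨m≡n (s≤s⁻¹ k<)
  ...   | inj₁ k<rx = let y , y<x , Qy , e = rank-surjective x k<rx in y , m<n⇒m<1+n y<x , Qy , e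
  ...   | inj₂ k≡rx = x , ≤-refl , Qx , sym k≡rx

  HasSize-rank : ∀ x → HasSize (λ y → y < x × Q y) (rank x)
  HasSize-rank zero = HasSize-∅ λ _ ()
  HasSize-rank (suc x) with Q? x
  ... | yes Qx = subst (HasSize _) (+-comm (rank x) 1)
        (HasSize-cong (λ y → mk⇔ (λ { (inj₁ (y<x , Qy)) → m<n⇒m<1+n y<x , Qy ; (inj₂ refl) → ≤-refl , Qx })
                                 (λ (y<1+x , Qy) → Sum.map (_, Qy) id (m≤n⇒m<n∨m≡n (s≤s⁻¹ y<1+x))))
          (HasSize-⊎ (HasSize-rank x) (HasSize-≡ x) λ { _ (x<x , _) refl → <-irrefl refl x<x }))
  ... | no ¬Qx = HasSize-cong
        (λ y → mk⇔ (λ (y<x , Qy) → m<n⇒m<1+n y<x , Qy)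
                   (λ (y<1+x , Qy) → ≤∧≢⇒< (s≤s⁻¹ y<1+x) (λ { refl → ¬Qx Qy }) , Qy))
        (HasSize-rank x)

  rank-reflects-< : ∀ {x y} → Q x → Q y → rank x < rank y → x < y
  rank-reflects-< {x} {y} Qx Qy rx<ry with <-cmp x y
  ... | tri< x<y _ _ = x<y
  ... | tri≈ _ refl _ = ⊥-elim (<-irrefl refl rx<ry)
  ... | tri> _ _ y<x = ⊥-elim (<-asym rx<ry (rank-strict Qy y<x))

  rank-injective : ∀ {x y} → Q x → Q y → rank x ≡ rank y → x ≡ y
  rank-injective {x} {y} Qx Qy rx≡ry with <-cmp x y
  ... | tri< x<y _ _ = ⊥-elim (<-irrefl rx≡ry (rank-strict Qx x<y))
  ... | tri≈ _ x≡y _ = x≡y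
  ... | tri> _ _ y<x = ⊥-elim (<-irrefl (sym rx≡ry) (rank-strict Qy y<x))

  map-rank-injective : ∀ {u w} → All Q u → All Q w → map rank u ≡ map rank w → u ≡ w
  map-rank-injective []          []          _ = refl
  map-rank-injective (Qx ∷ Qu) (Qy ∷ Qw) e =
    cong₂ _∷_ (rank-injective Qx Qy (∷-injectiveˡ e)) (map-rank-injective Qu Qw (∷-injectiveʳ e))

  is010∨110-rank⁺ : ∀ {x y z} → Q x → Q y → Q z → Is010∨110 x y z → Is010∨110 (rank x) (rank y) (rank z)
  is010∨110-rank⁺ Qx Qy Qz (inj₁ (refl , x<y)) = inj₁ (refl , rank-strict Qx x<y)
  is010∨110-rank⁺ Qx Qy Qz (inj₂ (refl , z<x)) = inj₂ (refl , rank-strict Qz z<x)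

  is010∨110-rank⁻ : ∀ {x y z} → Q x → Q y → Q z → Is010∨110 (rank x) (rank y) (rank z) → Is010∨110 x y z
  is010∨110-rank⁻ Qx Qy Qz (inj₁ (e , l)) = inj₁ (rank-injective Qx Qz e , rank-reflects-< Qx Qy l)
  is010∨110-rank⁻ Qx Qy Qz (inj₂ (e , l)) = inj₂ (rank-injective Qx Qy e , rank-reflects-< Qz Qx l)

  module _ {w : List ℕ} (Qw : All Q w) where

    private
      Q-head : ∀ {a s} → a ∷ s ⊆ w → Q a
      Q-head p = All.lookup Qw (to∈ p)

    has010∨110-map-rank⁺ : Has010∨110 w → Has010∨110 (map rank w)
    has010∨110-map-rank⁺ (x , y , z , p , occ) =
      rank x , rank y , rank z , map⁺ rank p ,
      is010∨110-rank⁺ (Q-head p) (Q-head (∷ˡ⁻ p)) (Q-head (∷ˡ⁻ (∷ˡ⁻ p))) occ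

    has010∨110-map-rank⁻ : Has010∨110 (map rank w) → Has010∨110 w
    has010∨110-map-rank⁻ (_ , _ , _ , p , occ) with ⊆-map⁻ rank w p
    ... | x ∷ y ∷ z ∷ [] , q , refl =
      x , y , z , q , is010∨110-rank⁻ (Q-head q) (Q-head (∷ˡ⁻ q)) (Q-head (∷ˡ⁻ (∷ˡ⁻ q))) occ

    avoidsP-map-rank⁺ : AvoidsP w → AvoidsP (map rank w)
    avoidsP-map-rank⁺ av = ¬has010∨110⇒avoidsP (avoidsP⇒¬has010∨110 av ∘ has010∨110-map-rank⁻)

    avoidsP-map-rank⁻ : AvoidsP (map rank w) → AvoidsP w
    avoidsP-map-rank⁻ av = ¬has010∨110⇒avoidsP (avoidsP⇒¬has010∨110 av ∘ has010∨110-map-rank⁺)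

    Forb-map-rank⁺ : ∀ {v} → Q v → Forb w v → Forb (map rank w) (rank v)
    Forb-map-rank⁺ Qv (inj₁ v∈w)          = inj₁ (∈-map⁺ rank v∈w)
    Forb-map-rank⁺ Qv (inj₂ (x , xx , v<x)) = inj₂ (rank x , map⁺ rank xx , rank-strict Qv v<x)

    Forb-map-rank⁻ : ∀ {u} → Forb (map rank w) u → ∃ λ v → Q v × Forb w v × rank v ≡ u
    Forb-map-rank⁻ (inj₁ u∈) with ∈-map⁻ rank u∈
    ... | v , v∈w , refl = v , All.lookup Qw v∈w , inj₁ v∈w , refl
    Forb-map-rank⁻ (inj₂ (_ , xx , u<x)) with ⊆-map⁻ rank w xx
    ... | x ∷ x′ ∷ [] , q , e with rank-injective (Q-head q) (Q-head (∷ˡ⁻ q))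
                                     (trans (sym (∷-injectiveˡ e)) (∷-injectiveˡ (∷-injectiveʳ e)))
    ...   | refl with rank-surjective x (subst (_ <_) (∷-injectiveˡ e) u<x)
    ...     | v , v<x , Qv , rv≡u = v , Qv , inj₂ (x , q , v<x) , rv≡u

-- The entry at 0-based position i is at most k + i; IsInvSeq is the case k = 0.
InvFrom : ℕ → List ℕ → Set
InvFrom k []       = ⊤
InvFrom k (x ∷ xs) = x ≤ k × InvFrom (suc k) xs

private
  InvFrom⇒lookup : ∀ k σ → InvFrom k σ → ∀ (i : Fin (length σ)) → lookup σ i ≤ k + toℕ i
  InvFrom⇒lookup k (x ∷ xs) (x≤k , inv) zero    = subst (x ≤_) (sym (+-identityʳ k)) x≤k
  InvFrom⇒lookup k (x ∷ xs) (x≤k , inv) (suc i) =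
    subst (lookup xs i ≤_) (sym (+-suc k (toℕ i))) (InvFrom⇒lookup (suc k) xs inv i)

  lookup⇒InvFrom : ∀ k σ → (∀ (i : Fin (length σ)) → lookup σ i ≤ k + toℕ i) → InvFrom k σ
  lookup⇒InvFrom k []       _     = tt
  lookup⇒InvFrom k (x ∷ xs) bound =
    subst (x ≤_) (+-identityʳ k) (bound zero) ,
    lookup⇒InvFrom (suc k) xs (λ i → subst (lookup xs i ≤_) (+-suc k (toℕ i)) (bound (suc i)))

IsInvSeq⇔InvFrom : ∀ {n σ} → IsInvSeq n σ ⇔ (length σ ≡ n × InvFrom 0 σ)
IsInvSeq⇔InvFrom {σ = σ} =
  mk⇔ (λ (len , bound) → len , lookup⇒InvFrom 0 σ bound) (λ (len , inv) → len , InvFrom⇒lookup 0 σ inv)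

InvFrom-++⁻ : ∀ k τ {ω} → InvFrom k (τ ++ ω) → InvFrom k τ × InvFrom (length τ + k) ω
InvFrom-++⁻ k []      inv          = tt , inv
InvFrom-++⁻ k (x ∷ τ) {ω} (x≤k , inv) with InvFrom-++⁻ (suc k) τ inv
... | invτ , invω = (x≤k , invτ) , subst (λ t → InvFrom t ω) (+-suc (length τ) k) invω

InvFrom-++⁺ : ∀ k τ {ω} → InvFrom k τ → InvFrom (length τ + k) ω → InvFrom k (τ ++ ω)
InvFrom-++⁺ k []      _            invω = invω
InvFrom-++⁺ k (x ∷ τ) {ω} (x≤k , invτ) invω =
  x≤k , InvFrom-++⁺ (suc k) τ invτ (subst (λ t → InvFrom t ω) (sym (+-suc (length τ) k)) invω)

InvFrom-bounded : ∀ {B k ω} → All (_≤ B) ω → B ≤ k → InvFrom k ω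
InvFrom-bounded []          _   = tt
InvFrom-bounded (x≤B ∷ ω≤B) B≤k = ≤-trans x≤B B≤k , InvFrom-bounded ω≤B (m≤n⇒m≤1+n B≤k)

split-at-first : ∀ {m σ} → m ∈ σ → ∃ λ τ → ∃ λ ω → m ∉ τ × σ ≡ τ ++ m ∷ ω
split-at-first {m} {x ∷ σ} m∈ with x ≟ m
... | yes refl = [] , σ , (λ ()) , refl
split-at-first {m} {x ∷ σ} (here m≡x) | no x≢m = ⊥-elim (x≢m (sym m≡x))
split-at-first {m} {x ∷ σ} (there m∈σ) | no x≢m with split-at-first m∈σ
... | τ , ω , m∉τ , refl = x ∷ τ , ω , (λ { (here m≡x) → x≢m (sym m≡x) ; (there m∈τ) → m∉τ m∈τ }) , refl

++∷-cancel : ∀ {m : ℕ} τ τ′ {ω ω′} → m ∉ τ → m ∉ τ′ → τ ++ m ∷ ω ≡ τ′ ++ m ∷ ω′ → τ ≡ τ′ × ω ≡ ω′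
++∷-cancel []      []       _   _    refl = refl , refl
++∷-cancel []      (_ ∷ _)  _   m∉τ′ refl = ⊥-elim (m∉τ′ (here refl))
++∷-cancel (_ ∷ _) []       m∉τ _    refl = ⊥-elim (m∉τ (here refl))
++∷-cancel (x ∷ τ) (_ ∷ τ′) m∉τ m∉τ′ e with ∷-injective e
... | refl , e′ with ++∷-cancel τ τ′ (m∉τ ∘ there) (m∉τ′ ∘ there) e′
... | refl , refl = refl , refl

length-++∷⁻ : ∀ {A : Set} (τ : List A) {x ω N} → length (τ ++ x ∷ ω) ≡ N →
              length τ < N × length ω ≡ N ∸ suc (length τ)
length-++∷⁻ τ {x} {ω} refl rewrite length-++ τ {x ∷ ω} | +-suc (length τ) (length ω) =
  s≤s (m≤m+n (length τ) (length ω)) , sym (m+n∸m≡n (length τ) (length ω))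

length-++∷⁺ : ∀ {A : Set} (τ : List A) {x ω ℓ N} → length τ ≡ ℓ → ℓ < N → length ω ≡ N ∸ suc ℓ →
              length (τ ++ x ∷ ω) ≡ N
length-++∷⁺ τ {x} {ω} {ℓ} {N} refl ℓ<N |ω|≡ = begin
  length (τ ++ x ∷ ω)        ≡⟨ length-++ τ ⟩
  length τ + suc (length ω)  ≡⟨ cong (λ t → length τ + suc t) |ω|≡ ⟩
  ℓ + suc (N ∸ suc ℓ)        ≡⟨ +-suc ℓ _ ⟩
  suc ℓ + (N ∸ suc ℓ)        ≡⟨ m+[n∸m]≡n ℓ<N ⟩
  N                          ∎
  where open ≡-Reasoning

All-≡⇒replicate : ∀ {m : ℕ} ω → All (_≡ m) ω → ω ≡ replicate (length ω) m
All-≡⇒replicate []      []             = refl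
All-≡⇒replicate (x ∷ ω) (refl ∷ ω≡m) = cong (x ∷_) (All-≡⇒replicate ω ω≡m)

δ-refl : ∀ a → δ a a ≡ 1
δ-refl zero    = refl
δ-refl (suc a) = δ-refl a

δ-≢ : ∀ {a c} → a ≢ c → δ a c ≡ 0
δ-≢ {zero}  {zero}  a≢c = ⊥-elim (a≢c refl)
δ-≢ {zero}  {suc c} _   = refl
δ-≢ {suc a} {zero}  _   = refl
δ-≢ {suc a} {suc c} a≢c = δ-≢ (a≢c ∘ cong suc)

-- The tails ω after the first maximum m of σ = τ · m · ω

TailOf : (m f N : ℕ) → List ℕ → List ℕ → Set
TailOf m f N τ ω =
  length ω ≡ N × All (_≤ m) ω × AvoidsP (τ ++ m ∷ ω) × HasSize (Forbidden P010-110 (τ ++ m ∷ ω)) f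

module Tails (m f N : ℕ) {τ : List ℕ} {i : ℕ}
  (τ<m : All (_< m) τ) (avτ : AvoidsP τ) (Forbτ : HasSize (Forb τ) i) (i<f : i < f) where

  σ : List ℕ → List ℕ
  σ ω = τ ++ m ∷ ω

  Tail : List ℕ → Set
  Tail = TailOf m f N τ

  open Rank (¬? ∘ forb? τ)

  Letter : ℕ → Set
  Letter x = x < m × Allowed τ x

  rank-m : rank m ≡ m ∸ i
  rank-m = begin
    rank m           ≡⟨ m+n∸m≡n i (rank m) ⟨
    i + rank m ∸ i   ≡⟨ cong (_∸ i) (HasSize-functional below-m (HasSize-<n m)) ⟩
    m ∸ i            ∎
    where
    open ≡-Reasoning
    below-m : HasSize (_< m) (i + rank m)
    below-m = HasSize-cong
      (λ v → mk⇔ (λ { (inj₁ f) → Forb-< τ<m f ; (inj₂ (v<m , _)) → v<m })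
                 (λ v<m → Sum.map id (v<m ,_) (toSum (forb? τ v))))
      (HasSize-⊎ Forbτ (HasSize-rank m) λ _ f (_ , allowed) → allowed f)

  private
    allowed : ∀ {ω} → All Letter ω → All (Allowed τ) ω
    allowed = All.map proj₂

    below : ∀ {ω} → All Letter ω → All (_< m) ω
    below = All.map proj₁

    m∉letters : ∀ {ω} → All Letter ω → m ∉ ω
    m∉letters ω-letters m∈ω = <-irrefl refl (All.lookup (below ω-letters) m∈ω)

    m-allowed : Allowed τ m
    m-allowed = <-irrefl refl ∘ Forb-< τ<m

  letters : ∀ {ω} → All (_≤ m) ω → m ∉ ω → All (Allowed τ) ω → All Letter ω
  letters []            _   []                   = []
  letters (x≤m ∷ ω≤m) m∉ω (x-allowed ∷ ω-allowed) =
    (≤∧≢⇒< x≤m (m∉ω ∘ here ∘ sym) , x-allowed) ∷ letters ω≤m (m∉ω ∘ there) ω-allowed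

  map-rank-letters : ∀ {ω} → All Letter ω → All (_< m ∸ i) (map rank ω)
  map-rank-letters []                                = []
  map-rank-letters {x ∷ _} ((x<m , x-allowed) ∷ ω) =
    subst (rank x <_) rank-m (rank-strict x-allowed x<m) ∷ map-rank-letters ω

  HasSize-letters : ∀ {R : List ℕ → Set} {k} → HasSize (λ ω′ → All (_< m ∸ i) ω′ × R ω′) k →
                    HasSize (λ ω → All Letter ω × R (map rank ω)) k
  HasSize-letters {R} size = HasSize-bijection (map rank) size
    (λ ω (ω-letters , Rω) → map-rank-letters ω-letters , Rω)
    (λ ω′ (ω′< , Rω′) → let ω , ω-letters , ω≡ = unrank ω′< in ω , (ω-letters , subst R (sym ω≡) Rω′) , ω≡)
    (λ (ω-letters , _) (ω′-letters , _) → map-rank-injective (allowed ω-letters) (allowed ω′-letters))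
    where
    unrank : ∀ {ω′} → All (_< m ∸ i) ω′ → ∃ λ ω → All Letter ω × map rank ω ≡ ω′
    unrank {[]}    []         = [] , [] , refl
    unrank {k ∷ _} (k< ∷ ω′<) =
      let x , x<m , x-allowed , rx≡k = rank-surjective m (subst (_ <_) (sym rank-m) k<)
          ω , ω-letters , ω≡ = unrank ω′<
      in x ∷ ω , (x<m , x-allowed) ∷ ω-letters , cong₂ _∷_ rx≡k ω≡

  HasSize-Forb-++∷ : ∀ {ω k} → All Letter ω → HasSize (Forb (map rank ω)) k → HasSize (Forb (σ ω)) (i + suc k)
  HasSize-Forb-++∷ {ω} {k} ω-letters Forbω′ =
    HasSize-cong (λ v → mk⇔ (Forb-++∷⁺ τ<m ∘ Sum.map₂ (Forb-∷⁺ ∘ Sum.map₂ proj₂)) (classify v))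
      (HasSize-⊎ Forbτ (HasSize-⊎ (HasSize-≡ m) Forbω disjoint-m) disjoint-τ)
    where
    Forbω : HasSize (λ v → Allowed τ v × Forb ω v) k
    Forbω = HasSize-bijection rank Forbω′
      (λ v (v-allowed , f) → Forb-map-rank⁺ (allowed ω-letters) v-allowed f)
      (λ u f → let v , v-allowed , fv , e = Forb-map-rank⁻ (allowed ω-letters) f in v , (v-allowed , fv) , e)
      (λ (v-allowed , _) (v′-allowed , _) → rank-injective v-allowed v′-allowed)
    disjoint-m : ∀ v → v ≡ m → ¬ (Allowed τ v × Forb ω v)
    disjoint-m v refl (_ , f) = <-irrefl refl (Forb-< (below ω-letters) f)
    disjoint-τ : ∀ v → Forb τ v → ¬ (v ≡ m ⊎ Allowed τ v × Forb ω v)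
    disjoint-τ v f (inj₁ refl)            = m-allowed f
    disjoint-τ v f (inj₂ (v-allowed , _)) = v-allowed f
    classify : ∀ v → Forb (σ ω) v → Forb τ v ⊎ (v ≡ m ⊎ Allowed τ v × Forb ω v)
    classify v f with Forb-++∷⁻ τ<m (allowed ω-letters) f
    ... | inj₁ fτ = inj₁ fτ
    ... | inj₂ fmω with Forb-∷⁻ (m∉letters ω-letters) fmω | forb? τ v
    ...   | inj₁ v≡m | _       = inj₂ (inj₁ v≡m)
    ...   | inj₂ fω  | yes fτ  = inj₁ fτ
    ...   | inj₂ fω  | no ¬fτ  = inj₂ (inj₂ (¬fτ , fω))

  private
    i+1+[f∸i∸1]≡f : i + suc (f ∸ i ∸ 1) ≡ f
    i+1+[f∸i∸1]≡f = begin
      i + suc (f ∸ i ∸ 1) ≡⟨ cong (λ t → i + suc t) (∸-+-assoc f i 1) ⟩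
      i + suc (f ∸ (i + 1)) ≡⟨ cong (λ t → i + suc (f ∸ t)) (+-comm i 1) ⟩
      i + suc (f ∸ suc i) ≡⟨ +-suc i _ ⟩
      suc i + (f ∸ suc i) ≡⟨ m+[n∸m]≡n i<f ⟩
      f                   ∎
      where open ≡-Reasoning

    BWord : List ℕ → Set
    BWord ω′ = length ω′ ≡ N × AvoidsP ω′ × HasSize (Forbidden P010-110 ω′) (f ∸ i ∸ 1)

  HasSize-Tail∉ : ∀ {c} → IsB N (m ∸ i) (f ∸ i ∸ 1) c → HasSize (λ ω → Tail ω × m ∉ ω) c
  HasSize-Tail∉ isB =
    HasSize-cong (λ ω → mk⇔ fromLetters toLetters)
      (HasSize-letters (HasSize-cong (λ ω′ → mk⇔ (λ ((len , ω′<) , rest) → ω′< , len , rest)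
                                                  (λ (ω′< , len , rest) → (len , ω′<) , rest)) isB))
    where
    fromLetters : ∀ {ω} → All Letter ω × BWord (map rank ω) → Tail ω × m ∉ ω
    fromLetters {ω} (ω-letters , len , av , Forbω′) =
      (trans (sym (length-map rank ω)) len , All.map <⇒≤ (below ω-letters) , avσ ,
        to (HasSize-Forb⇔Forbidden avσ)
          (subst (HasSize _) i+1+[f∸i∸1]≡f
            (HasSize-Forb-++∷ ω-letters (from (HasSize-Forb⇔Forbidden av) Forbω′)))) ,
      m∉letters ω-letters
      where
      avσ = avoidsP-++∷⁺ τ<m avτ (allowed ω-letters)
              (avoidsP-∷-max (below ω-letters) (avoidsP-map-rank⁻ (allowed ω-letters) av))
    toLetters : ∀ {ω} → Tail ω × m ∉ ω → All Letter ω × BWord (map rank ω)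
    toLetters {ω} ((len , ω≤m , avσ , Forbσ) , m∉ω) =
      ω-letters , trans (length-map rank ω) len , av′ ,
      to (HasSize-Forb⇔Forbidden av′) (subst (HasSize _) k≡ Forbω′)
      where
      parts = avoidsP-++∷⁻ τ<m avσ
      ω-letters = letters ω≤m m∉ω (proj₁ (proj₂ parts))
      av′ = avoidsP-map-rank⁺ (allowed ω-letters) (avoidsP-antimono (m ∷ʳ ⊆-refl) (proj₂ (proj₂ parts)))
      Forbω′ = proj₂ (HasSize-Forb (map rank ω))
      k≡ : proj₁ (HasSize-Forb (map rank ω)) ≡ f ∸ i ∸ 1
      k≡ = suc-injective (+-cancelˡ-≡ i _ _ (trans
             (HasSize-functional (HasSize-Forb-++∷ ω-letters Forbω′) (from (HasSize-Forb⇔Forbidden avσ) Forbσ))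
             (sym i+1+[f∸i∸1]≡f)))

  Forb-σ-full : ∀ {ω} → m ∈ ω → All (_≤ m) ω → HasSize (Forb (σ ω)) (suc m)
  Forb-σ-full {ω} m∈ω ω≤m = HasSize-cong
    (λ v → mk⇔ (λ v<1+m → Forb-++∷⁺ τ<m (inj₂ (Forb-∷-repeated m∈ω (s≤s⁻¹ v<1+m))))
               (s≤s ∘ Forb-≤ σ≤m))
    (HasSize-<n (suc m))
    where
    σ≤m : All (_≤ m) (σ ω)
    σ≤m = All.++⁺ (All.map <⇒≤ τ<m) (≤-refl ∷ ω≤m)

  Tail∈⇒f≡1+m : ∀ {ω} → Tail ω → m ∈ ω → f ≡ suc m
  Tail∈⇒f≡1+m (_ , ω≤m , avσ , Forbσ) m∈ω =
    HasSize-functional (from (HasSize-Forb⇔Forbidden avσ) Forbσ) (Forb-σ-full m∈ω ω≤m)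

  Word : ℕ → List ℕ → Set
  Word ℓ ω₁ = All Letter ω₁ × length ω₁ ≡ ℓ × AvoidsP ω₁

  HasSize-Word : ∀ {ℓ c} → IsW ℓ (m ∸ i) c → HasSize (Word ℓ) c
  HasSize-Word isW = HasSize-cong
    (λ ω₁ → mk⇔ (λ (ω₁-letters , len , av) → ω₁-letters , trans (sym (length-map rank ω₁)) len ,
                                                avoidsP-map-rank⁻ (allowed ω₁-letters) av)
                (λ (ω₁-letters , len , av) → ω₁-letters , trans (length-map rank ω₁) len ,
                                                avoidsP-map-rank⁺ (allowed ω₁-letters) av))
    (HasSize-letters (HasSize-cong (λ ω′ → mk⇔ (λ ((len , ω′<) , av) → ω′< , len , av)
                                                (λ (ω′< , len , av) → (len , ω′<) , av)) isW))

  -- m ∈ ω forces every entry after the first m in ω to be m itself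
  padded : ℕ → List ℕ → List ℕ
  padded ℓ ω₁ = ω₁ ++ m ∷ replicate (N ∸ suc ℓ) m

  Padded : List ℕ → Set
  Padded ω = ∃ λ ℓ → ℓ ∈ upTo N × ∃ λ ω₁ → Word ℓ ω₁ × ω ≡ padded ℓ ω₁

  HasSize-Padded : ∀ w → (∀ ℓ → IsW ℓ (m ∸ i) (w ℓ (m ∸ i))) → HasSize Padded (cShift w N (m ∸ i))
  HasSize-Padded w isW = HasSize-⋃ (upTo N) (Unique.upTo⁺ N) Word (λ ℓ → w ℓ (m ∸ i)) padded
    (λ ℓ _ → HasSize-Word (isW ℓ))
    λ {_} {_} {ω₁} {ω₁′} _ _ (ω₁-letters , len , _) (ω₁′-letters , len′ , _) e →
      let ω₁≡ , _ = ++∷-cancel ω₁ ω₁′ (m∉letters ω₁-letters) (m∉letters ω₁′-letters) e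
      in trans (sym len) (trans (cong length ω₁≡) len′) , ω₁≡

  padded-Tail : f ≡ suc m → ∀ {ω} → Padded ω → Tail ω × m ∈ ω
  padded-Tail f≡1+m (ℓ , ℓ∈ , ω₁ , (ω₁-letters , len , av) , refl) =
    (length-padded , ω≤m , avσ ,
      to (HasSize-Forb⇔Forbidden avσ) (subst (HasSize _) (sym f≡1+m) (Forb-σ-full m∈ω ω≤m))) ,
    m∈ω
    where
    k = N ∸ suc ℓ
    m∈ω = ∈-++⁺ʳ ω₁ (here refl)
    length-padded : length (padded ℓ ω₁) ≡ N
    length-padded = length-++∷⁺ ω₁ len (∈-upTo⁻ ℓ∈) (length-replicate k)
    ω≤m : All (_≤ m) (padded ℓ ω₁)
    ω≤m = All.++⁺ (All.map <⇒≤ (below ω₁-letters)) (≤-refl ∷ All.replicate⁺ k ≤-refl)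
    avσ : AvoidsP (σ (padded ℓ ω₁))
    avσ = avoidsP-++∷⁺ τ<m avτ (All.++⁺ (allowed ω₁-letters) (All.replicate⁺ (suc k) m-allowed))
            (avoidsP-++-replicate (suc k) (≤-refl ∷ All.map <⇒≤ (below ω₁-letters))
              (avoidsP-∷-max (below ω₁-letters) av))

  Tail-padded : ∀ {ω} → Tail ω → m ∈ ω → Padded ω
  Tail-padded (len , ω≤m , avσ , _) m∈ω with split-at-first m∈ω
  ... | ω₁ , ω₂ , m∉ω₁ , refl =
    length ω₁ , ∈-upTo⁺ ℓ<N , ω₁ , (ω₁-letters , refl , avω₁) ,
    cong (λ t → ω₁ ++ m ∷ t) (trans (All-≡⇒replicate ω₂ ω₂≡m) (cong (λ t → replicate t m) len₂))
    where
    ℓ<N = proj₁ (length-++∷⁻ ω₁ len)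
    len₂ = proj₂ (length-++∷⁻ ω₁ len)
    parts = avoidsP-++∷⁻ τ<m avσ
    avmω = proj₂ (proj₂ parts)
    ω₁-letters : All Letter ω₁
    ω₁-letters = letters (All.++⁻ˡ ω₁ ω≤m) m∉ω₁ (All.++⁻ˡ ω₁ (proj₁ (proj₂ parts)))
    avω₁ : AvoidsP ω₁
    avω₁ = avoidsP-antimono (m ∷ʳ ++⁺ʳ _ ⊆-refl) avmω
    ω₂≡m : All (_≡ m) ω₂
    ω₂≡m = All.tabulate λ z∈ω₂ → is-m z∈ω₂ (m≤n⇒m<n∨m≡n (All.lookup (All.++⁻ʳ ω₁ ω≤m) (there z∈ω₂)))
      where
      -- z < m after two m's would be an occurrence of 110
      is-m : ∀ {z} → z ∈ ω₂ → z < m ⊎ z ≡ m → z ≡ m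
      is-m _ (inj₂ z≡m) = z≡m
      is-m {z} z∈ω₂ (inj₁ z<m) = ⊥-elim (avoidsP⇒¬has010∨110 avmω
        (m , m , z , refl ∷ ++⁺ˡ ω₁ (refl ∷ from∈ z∈ω₂) , inj₂ (refl , z<m)))

  HasSize-Tail∈ : ∀ w → (∀ ℓ → IsW ℓ (m ∸ i) (w ℓ (m ∸ i))) →
                  HasSize (λ ω → Tail ω × m ∈ ω) (δ f (suc m) * cShift w N (m ∸ i))
  HasSize-Tail∈ w isW with f ≟ suc m
  ... | yes f≡1+m =
    subst (HasSize _) (sym (trans (cong (_* cShift w N (m ∸ i)) δ≡1) (*-identityˡ _)))
      (HasSize-cong (λ ω → mk⇔ (padded-Tail f≡1+m) (λ (t , m∈ω) → Tail-padded t m∈ω)) (HasSize-Padded w isW))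
    where
    δ≡1 : δ f (suc m) ≡ 1
    δ≡1 = trans (cong (λ t → δ t (suc m)) f≡1+m) (δ-refl (suc m))
  ... | no f≢1+m rewrite δ-≢ f≢1+m = HasSize-∅ λ ω (t , m∈ω) → f≢1+m (Tail∈⇒f≡1+m t m∈ω)

  HasSize-Tail : ∀ b w → IsB N (m ∸ i) (f ∸ i ∸ 1) b → (∀ ℓ → IsW ℓ (m ∸ i) (w ℓ (m ∸ i))) →
                 HasSize Tail (b + δ f (suc m) * cShift w N (m ∸ i))
  HasSize-Tail b w isB isW =
    HasSize-cong (λ ω → mk⇔ (Sum.[ proj₁ , proj₁ ]) (λ t → Sum.map (t ,_) (t ,_) (Sum.swap (toSum (m ∈? ω)))))
      (HasSize-⊎ (HasSize-Tail∉ isB) (HasSize-Tail∈ w isW) λ ω (_ , m∉ω) (_ , m∈ω) → m∉ω m∈ω)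

-- Counting by the prefix before the first maximum

Counted : ℕ → ℕ → ℕ → List ℕ → Set
Counted n m f σ = IsInvSeq n σ × AvoidsP σ × (maxℤ σ ≡ + m) × HasSize (Forbidden P010-110 σ) f

module _ (a b : ℕ → ℕ → ℕ → ℕ) (w : ℕ → ℕ → ℕ)
  (isA : ∀ n m f → IsA n m f (a n m f)) (isB : ∀ n k f → IsB n k f (b n k f))
  (isW : ∀ ℓ k → IsW ℓ k (w ℓ k))
  {n m f : ℕ} (1≤f : 1 ≤ f) (1≤m : 1 ≤ m) where

  Fibre : ℕ → ℕ → ℕ → List ℕ → Set
  Fibre p i j σ = ∃ λ τ → Counted (p ∸ 1) j i τ × ∃ λ ω → TailOf m f (n ∸ p) τ ω × σ ≡ τ ++ m ∷ ω

  private
    <m : ∀ {τ j} → maxℤ τ ≡ + j → j < m → All (_< m) τ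
    <m max≡j j<m = All.map (λ x≤j → ≤-<-trans x≤j j<m) (proj₂ (maxℤ≡⇒ max≡j))

    <⇒∉ : ∀ {τ} → All (_< m) τ → m ∉ τ
    <⇒∉ τ<m m∈τ = <-irrefl refl (All.lookup τ<m m∈τ)

    <⇒≤∸1 : ∀ {x k} → x < k → x ≤ k ∸ 1
    <⇒≤∸1 {k = suc k} (s≤s x≤k) = x≤k

    ≤∸1⇒< : ∀ {x k} → 1 ≤ k → x ≤ k ∸ 1 → x < k
    ≤∸1⇒< {k = suc k} _ x≤k = s≤s x≤k

  fibres-disjoint : ∀ {p i j p′ i′ j′ σ} → j < m → j′ < m → Fibre p i j σ → Fibre p′ i′ j′ σ →
                    p ∸ 1 ≡ p′ ∸ 1 × i ≡ i′ × j ≡ j′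
  fibres-disjoint j<m j′<m (τ , (invτ , _ , maxτ , Forbτ) , ω , _ , refl)
                           (τ′ , (invτ′ , _ , maxτ′ , Forbτ′) , ω′ , _ , e)
    with ++∷-cancel τ τ′ (<⇒∉ (<m maxτ j<m)) (<⇒∉ (<m maxτ′ j′<m)) e
  ... | refl , refl =
    trans (sym (proj₁ invτ)) (proj₁ invτ′) ,
    HasSize-functional Forbτ Forbτ′ ,
    ℤ.+-injective (trans (sym maxτ) maxτ′)

  tails : ℕ → ℕ → ℕ
  tails p i = b (n ∸ p) (m ∸ i) (f ∸ i ∸ 1) + δ f (suc m) * cShift w (n ∸ p) (m ∸ i)

  HasSize-Fibre : ∀ p i j → i < f → j < m → HasSize (Fibre p i j) (a (p ∸ 1) j i * tails p i)
  HasSize-Fibre p i j i<f j<m =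
    HasSize-⋃-const (TailOf m f (n ∸ p)) (tails p i) (λ τ ω → τ ++ m ∷ ω) (isA (p ∸ 1) j i)
      (λ τ (_ , avτ , maxτ , Forbτ) →
        Tails.HasSize-Tail m f (n ∸ p) (<m maxτ j<m) avτ (from (HasSize-Forb⇔Forbidden avτ) Forbτ) i<f
          _ w (isB (n ∸ p) (m ∸ i) (f ∸ i ∸ 1)) (λ ℓ → isW ℓ (m ∸ i)))
      (λ (_ , _ , maxτ , _) (_ , _ , maxτ′ , _) _ _ → ++∷-cancel _ _ (<⇒∉ (<m maxτ j<m)) (<⇒∉ (<m maxτ′ j<m)))

  Fibreⱼ : ℕ → ℕ → List ℕ → Set
  Fibreⱼ p i σ = ∃ λ j → 0 ≤ j × j ≤ m ∸ 1 × Fibre p i j σ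

  Fibreᵢ : ℕ → List ℕ → Set
  Fibreᵢ p σ = ∃ λ i → 0 ≤ i × i ≤ f ∸ 1 × Fibreⱼ p i σ

  Decomposed : List ℕ → Set
  Decomposed σ = ∃ λ p → suc m ≤ p × p ≤ n × Fibreᵢ p σ

  private
    fibresᵢ-disjoint : ∀ {p p′ σ} (F : Fibreᵢ p σ) (F′ : Fibreᵢ p′ σ) → p ∸ 1 ≡ p′ ∸ 1 × proj₁ F ≡ proj₁ F′
    fibresᵢ-disjoint {p} {p′} (_ , _ , _ , _ , _ , j≤ , F) (_ , _ , _ , _ , _ , j′≤ , F′) =
      let p≡p′ , i≡i′ , _ = fibres-disjoint {p} {p′ = p′} (≤∸1⇒< 1≤m j≤) (≤∸1⇒< 1≤m j′≤) F F′ in p≡p′ , i≡i′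

  HasSize-Fibreⱼ : ∀ p i → i < f → HasSize (Fibreⱼ p i) (sumRange 0 (m ∸ 1) λ j → a (p ∸ 1) j i * tails p i)
  HasSize-Fibreⱼ p i i<f = HasSize-⋃-range 0 (m ∸ 1) (Fibre p i) _
    (λ j _ j≤ → HasSize-Fibre p i j i<f (≤∸1⇒< 1≤m j≤))
    (λ _ j≤ F _ j′≤ F′ →
      proj₂ (proj₂ (fibres-disjoint {p} {i} {p′ = p} {i} (≤∸1⇒< 1≤m j≤) (≤∸1⇒< 1≤m j′≤) F F′)))

  HasSize-Fibreᵢ : ∀ p → HasSize (Fibreᵢ p)
    (sumRange 0 (f ∸ 1) λ i → sumRange 0 (m ∸ 1) λ j → a (p ∸ 1) j i * tails p i)
  HasSize-Fibreᵢ p = HasSize-⋃-range 0 (f ∸ 1) (Fibreⱼ p) _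
    (λ i _ i≤ → HasSize-Fibreⱼ p i (≤∸1⇒< 1≤f i≤))
    (λ _ i≤ F _ i′≤ F′ → proj₂ (fibresᵢ-disjoint {p} {p} (_ , z≤n , i≤ , F) (_ , z≤n , i′≤ , F′)))

  HasSize-Decomposed : HasSize Decomposed
    (sumRange (suc m) n λ p → sumRange 0 (f ∸ 1) λ i → sumRange 0 (m ∸ 1) λ j → a (p ∸ 1) j i * tails p i)
  HasSize-Decomposed = HasSize-⋃-range (suc m) n Fibreᵢ _
    (λ p _ _ → HasSize-Fibreᵢ p)
    (λ { {suc p} {suc p′} _ _ F _ _ F′ → cong suc (proj₁ (fibresᵢ-disjoint {suc p} {suc p′} F F′)) })

  Decomposed⇒Counted : ∀ {σ} → Decomposed σ → Counted n m f σ
  Decomposed⇒Counted (suc q , m<1+q , 1+q≤n , _ , _ , _ , j , _ , j≤ ,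
                      τ , (invτ , _ , maxτ , _) , ω , (lenω , ω≤m , avσ , Forbσ) , refl) =
    from IsInvSeq⇔InvFrom (lenσ , invσ) , avσ , maxℤ≡⇐ (∈-++⁺ʳ τ (here refl)) σ≤m , Forbσ
    where
    lenτ : length τ ≡ q
    lenτ = proj₁ (to (IsInvSeq⇔InvFrom {σ = τ}) invτ)
    lenσ : length (τ ++ m ∷ ω) ≡ n
    lenσ = length-++∷⁺ τ lenτ 1+q≤n lenω
    m≤|τ|+0 : m ≤ length τ + 0
    m≤|τ|+0 = subst (m ≤_) (sym (trans (+-identityʳ _) lenτ)) (s≤s⁻¹ m<1+q)
    invσ : InvFrom 0 (τ ++ m ∷ ω)
    invσ = InvFrom-++⁺ 0 τ (proj₂ (to (IsInvSeq⇔InvFrom {σ = τ}) invτ))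
             (m≤|τ|+0 , InvFrom-bounded ω≤m (m≤n⇒m≤1+n m≤|τ|+0))
    σ≤m : All (_≤ m) (τ ++ m ∷ ω)
    σ≤m = All.++⁺ (All.map <⇒≤ (<m maxτ (≤∸1⇒< 1≤m j≤))) (≤-refl ∷ ω≤m)

  Counted⇒Decomposed : ∀ {σ} → Counted n m f σ → Decomposed σ
  Counted⇒Decomposed {σ} (invσ , avσ , maxσ , Forbσ) with split-at-first (proj₁ (maxℤ≡⇒ {σ} maxσ))
  ... | τ , ω , m∉τ , refl =
    suc (length τ) , s≤s m≤|τ| , |τ|<n ,
    i , z≤n , <⇒≤∸1 i<f ,
    j , z≤n , <⇒≤∸1 j<m ,
    τ , (from IsInvSeq⇔InvFrom (refl , proj₁ invs) , avτ , maxτ , to (HasSize-Forb⇔Forbidden avτ) Forbτ) ,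
    ω , (lenω , All.tail (All.++⁻ʳ τ σ≤m) , avσ , Forbσ) , refl
    where
    σ≤m = proj₂ (maxℤ≡⇒ {τ ++ m ∷ ω} maxσ)
    lenσ = proj₁ (to (IsInvSeq⇔InvFrom {σ = τ ++ m ∷ ω}) invσ)
    invs = InvFrom-++⁻ 0 τ (proj₂ (to (IsInvSeq⇔InvFrom {σ = τ ++ m ∷ ω}) invσ))
    m≤|τ| : m ≤ length τ
    m≤|τ| = subst (m ≤_) (+-identityʳ _) (proj₁ (proj₂ invs))
    |τ|<n = proj₁ (length-++∷⁻ τ lenσ)
    lenω = proj₂ (length-++∷⁻ τ lenσ)
    τ<m : All (_< m) τ
    τ<m = All.tabulate λ x∈τ → ≤∧≢⇒< (All.lookup (All.++⁻ˡ τ σ≤m) x∈τ) λ { refl → m∉τ x∈τ }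
    avτ = avoidsP-antimono (++⁺ʳ _ ⊆-refl) avσ
    j = proj₁ (maxℤ-nonempty τ (≤-trans 1≤m m≤|τ|))
    maxτ = proj₂ (maxℤ-nonempty τ (≤-trans 1≤m m≤|τ|))
    j<m : j < m
    j<m = All.lookup τ<m (proj₁ (maxℤ≡⇒ maxτ))
    i = proj₁ (HasSize-Forb τ)
    Forbτ = proj₂ (HasSize-Forb τ)
    i<f : i < f
    i<f = HasSize-< Forbτ (from (HasSize-Forb⇔Forbidden avσ) Forbσ) (λ _ → Forb-mono (++⁺ʳ _ ⊆-refl))
            m (inj₁ (∈-++⁺ʳ τ (here refl))) (<-irrefl refl ∘ Forb-< τ<m)

theorem21 : (a b : ℕ → ℕ → ℕ → ℕ) (w : ℕ → ℕ → ℕ) →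
    (∀ n m f → IsA n m f (a n m f)) →
    (∀ n k f → IsB n k f (b n k f)) →
    (∀ ℓ k → IsW ℓ k (w ℓ k)) →
    ∀ (n m f : ℕ) → 2 ≤ f → f ≤ suc m → suc m ≤ n →
    a n m f ≡
      sumRange (suc m) n (λ p →
        sumRange 0 (f ∸ 1) (λ i →
          sumRange 0 (m ∸ 1) (λ j →
            a (p ∸ 1) j i *
              (b (n ∸ p) (m ∸ i) (f ∸ i ∸ 1)
                + δ f (suc m) * cShift w (n ∸ p) (m ∸ i)))))
theorem21 a b w isA isB isW n m f 2≤f f≤1+m _ =
  HasSize-functional (isA n m f)
    (HasSize-cong (λ _ → mk⇔ (Decomposed⇒Counted a b w isA isB isW 1≤f 1≤m)
                             (Counted⇒Decomposed a b w isA isB isW 1≤f 1≤m))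
      (HasSize-Decomposed a b w isA isB isW 1≤f 1≤m))
  where
  1≤f : 1 ≤ f
  1≤f = ≤-trans (n≤1+n 1) 2≤f
  1≤m : 1 ≤ m
  1≤m = s≤s⁻¹ (≤-trans 2≤f f≤1+m)
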